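{- Let $r\ge1$ be an integer and let $(U,R_1,\ldots,R_T,\pi^0)$ be an $r$-bounded instance of $\mathrm{Mult}\text{ - }\mathrm{MSSC}$. Let $\pi^0,\pi^1,\ldots,\pi^T$ be the permutations produced by the greedy-rounding algorithm (described in the context) and $e_1,\ldots,e_T$ the elements it moves to the first position at rounds $1,\ldots,T$. For any sequence of $n\times n$ doubly stochastic matrices $\hat A^0=\pi^0,\hat A^1,\ldots,\hat A^T$ such that (i) all entries of each $\hat A^t$ are multiples of $1/r$ and (ii) $\hat A^t_{e_t1}\ge1/r$ for all $t=1,\ldots,T$, we have $\sum_{t=1}^T\mathrm{d}_{\mathrm{KT}}(\pi^t,\pi^{t-1})\le2r^2\cdot\sum_{t=1}^T\mathrm{d}_{\mathrm{FR}}(\hat A^t,\hat A^{t-1})+r\cdot T$.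
   Context: $U$ is a finite set of $n$ elements; a permutation $\pi$ of $U$ is identified with the $0$-$1$ matrix with $A_{ei}=1$ iff $e$ is at position $i$ (rows = elements, columns = positions). $\mathrm{Mult}\text{ - }\mathrm{MSSC}$ instance: requests $R_1,\ldots,R_T\subseteq U$ and initial permutation $\pi^0$; it is $r$-bounded if $|R_t|\le r$ for all $t$. $\mathrm{d}_{\mathrm{KT}}(\pi,\sigma)$ is the number of pairs of elements ordered differently by permutations $\pi,\sigma$. A nonnegative $n\times n$ matrix is doubly stochastic if all row and column sums equal $1$ (stochastic if only row sums equal $1$). For stochastic $A,B$, $\mathrm{d}_{\mathrm{FR}}(A,B)$ is the optimal value of: minimize $\sum_{e}\sum_{i,j}|i-j|f^e_{ij}$ s.t. $\sum_i f^e_{ij}=B_{ej}$, $\sum_j f^e_{ij}=A_{ei}$, $f^e_{ij}\ge0$. Fractional-MTF: minimize $\sum_{t=1}^T\mathrm{d}_{\mathrm{FR}}(A^t,A^{t-1})$ over doubly stochastic $A^1,\ldots,A^T$ with $\sum_{e\in R_t}A^t_{e1}=1$ for all $t$ and $A^0=\pi^0$. Greedy-rounding algorithm: compute an optimal solution $A^0=\pi^0,A^1,\ldots,A^T$ of Fractional-MTF; for $t=1,\ldots,T$ choose $e_t\in R_t$ with $A^t_{e_t1}\ge1/r$ and let $\pi^t$ be $\pi^{t-1}$ with $e_t$ moved to the first position (relative order of other elements unchanged).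
   Formalization: The optimal solution $A^0=\pi^0,A^1,\ldots,A^T$, the feasible solutions it is compared with, the matrices $\hat A^t$ and the flows defining $\mathrm{d}_{\mathrm{FR}}$ all take values in ℚ. -}

module Defs where

open import Data.Nat as ℕ using (ℕ; zero; suc; ∣_-_∣; NonZero)
open import Data.Fin using (Fin; zero; suc; toℕ)
open import Data.Fin.Subset using (Subset; _∈_; ∣_∣)
open import Data.Fin.Subset.Properties using (_∈?_)
open import Data.Fin.Permutation using (Permutation′; _⟨$⟩ʳ_)
open import Data.Integer using (+_)
open import Data.Rational as ℚ using (ℚ; 0ℚ; 1ℚ; _/_)
open import Data.Bool using (Bool; true; false; if_then_else_; _xor_)
open import Data.Product using (Σ; _×_; ∃)
open import Relation.Nullary using (does)
open import Relation.Binary.PropositionalEquality using (_≡_)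
import Data.Fin as F

ℕ→ℚ : ℕ → ℚ
ℕ→ℚ k = (+ k) / 1

sumℕ : ∀ {n} → (Fin n → ℕ) → ℕ
sumℕ {zero}  f = 0
sumℕ {suc n} f = f zero ℕ.+ sumℕ (λ i → f (suc i))

sumℚ : ∀ {n} → (Fin n → ℚ) → ℚ
sumℚ {zero}  f = 0ℚ
sumℚ {suc n} f = f zero ℚ.+ sumℚ (λ i → f (suc i))

sumRoundsℕ : ℕ → (ℕ → ℕ) → ℕ
sumRoundsℕ zero    f = 0
sumRoundsℕ (suc T) f = sumRoundsℕ T f ℕ.+ f (suc T)

sumRoundsℚ : ℕ → (ℕ → ℚ) → ℚ
sumRoundsℚ zero    f = 0ℚ
sumRoundsℚ (suc T) f = sumRoundsℚ T f ℚ.+ f (suc T)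

Round : ℕ → ℕ → Set
Round T t = (1 ℕ.≤ t) × (t ℕ.≤ T)

-- Rows = elements of U = Fin n, columns = positions (position 1 is `zero`).
Matrix : ℕ → Set
Matrix n = Fin n → Fin n → ℚ

-- A permutation π maps each element to its position.
-- Its 0-1 matrix: entry (e,i) is 1 iff e is at position i.
permMat : ∀ {n} → Permutation′ n → Matrix n
permMat π e i = if does ((π ⟨$⟩ʳ e) F.≟ i) then 1ℚ else 0ℚ

DoublyStochastic : ∀ {n} → Matrix n → Set
DoublyStochastic {n} A =
  (∀ e i → 0ℚ ℚ.≤ A e i) ×
  (∀ e → sumℚ (λ i → A e i) ≡ 1ℚ) ×
  (∀ i → sumℚ (λ e → A e i) ≡ 1ℚ)

dKT : ∀ {n} → Permutation′ n → Permutation′ n → ℕ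
dKT π σ = sumℕ λ x → sumℕ λ y →
  if does (x F.<? y)
  then (if does ((π ⟨$⟩ʳ x) F.<? (π ⟨$⟩ʳ y)) xor does ((σ ⟨$⟩ʳ x) F.<? (σ ⟨$⟩ʳ y))
        then 1 else 0)
  else 0

-- Flows for the transportation LP defining d_FR(A,B):
-- Σ_i f^e_{ij} = B_{ej}, Σ_j f^e_{ij} = A_{ei}, f^e_{ij} ≥ 0.
Flow : ℕ → Set
Flow n = Fin n → Fin n → Fin n → ℚ

IsFlow : ∀ {n} → Matrix n → Matrix n → Flow n → Set
IsFlow A B f =
  (∀ e i j → 0ℚ ℚ.≤ f e i j) ×
  (∀ e j → sumℚ (λ i → f e i j) ≡ B e j) ×
  (∀ e i → sumℚ (λ j → f e i j) ≡ A e i)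

flowCost : ∀ {n} → Flow n → ℚ
flowCost f = sumℚ λ e → sumℚ λ i → sumℚ λ j →
  ℕ→ℚ ∣ toℕ i - toℕ j ∣ ℚ.* f e i j

IsDFR : ∀ {n} → Matrix n → Matrix n → ℚ → Set
IsDFR A B v =
  (Σ _ λ f → IsFlow A B f × (flowCost f ≡ v)) ×
  (∀ f → IsFlow A B f → v ℚ.≤ flowCost f)

sumOverSubset : ∀ {n} → Subset n → (Fin n → ℚ) → ℚ
sumOverSubset R g = sumℚ λ e → if does (e ∈? R) then g e else 0ℚ

-- Feasible solutions of Fractional-MTF (matrices indexed by t ∈ ℕ; only
-- t = 0..T are relevant).
FeasibleMTF : ∀ {m} → ℕ → (ℕ → Subset (suc m)) → Permutation′ (suc m)
              → (ℕ → Matrix (suc m)) → Set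
FeasibleMTF T R π0 A =
  (∀ e i → A 0 e i ≡ permMat π0 e i) ×
  (∀ t → Round T t → DoublyStochastic (A t)) ×
  (∀ t → Round T t → sumOverSubset (R t) (λ e → A t e zero) ≡ 1ℚ)

-- The Fractional-MTF objective value of A (given values v t with
-- IsDFR (A t) (A (t-1)) (v t)) is sumRoundsℚ T v.
DFRValues : ∀ {n} → ℕ → (ℕ → Matrix n) → (ℕ → ℚ) → Set
DFRValues T A v = ∀ t → Round T t → IsDFR (A t) (A (ℕ.pred t)) (v t)

OptimalMTF : ∀ {m} → ℕ → (ℕ → Subset (suc m)) → Permutation′ (suc m)
             → (ℕ → Matrix (suc m)) → Set
OptimalMTF T R π0 A =
  FeasibleMTF T R π0 A ×
  (Σ (ℕ → ℚ) λ v → DFRValues T A v ×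
     (∀ A' v' → FeasibleMTF T R π0 A' → DFRValues T A' v' →
        sumRoundsℚ T v ℚ.≤ sumRoundsℚ T v'))

MoveToFront : ∀ {n} → Permutation′ n → Fin n → Permutation′ n → Set
MoveToFront π e σ = ∀ x → toℕ (σ ⟨$⟩ʳ x) ≡
  (if does (x F.≟ e) then 0
   else if does ((π ⟨$⟩ʳ x) F.<? (π ⟨$⟩ʳ e)) then suc (toℕ (π ⟨$⟩ʳ x))
   else toℕ (π ⟨$⟩ʳ x))

-- Output (π, e) of the greedy-rounding algorithm run on the optimal
-- fractional solution A (any admissible choice of e_t).
GreedyRounding : ∀ {m} (r : ℕ) → .{{NonZero r}} → ℕ → (ℕ → Subset (suc m))
                 → Permutation′ (suc m) → (ℕ → Matrix (suc m))
                 → (ℕ → Permutation′ (suc m)) → (ℕ → Fin (suc m)) → Set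
GreedyRounding r T R π0 A π e =
  (∀ x → π 0 ⟨$⟩ʳ x ≡ π0 ⟨$⟩ʳ x) ×
  (∀ t → Round T t →
     (e t ∈ R t) ×
     ((+ 1) / r ℚ.≤ A t (e t) zero) ×
     MoveToFront (π (ℕ.pred t)) (e t) (π t))

MultiplesOf1/ : (r : ℕ) → .{{NonZero r}} → ∀ {n} → Matrix n → Set
MultiplesOf1/ r A = ∀ e i → ∃ λ (k : ℕ) → A e i ≡ (+ k) / r

-- Amortised analysis with potential Φ_t, the number of pairs of elements that π_t orders
-- against the leftmost supports f_t(x) = min {i : Â^t_{x,i} > 0}. As the positive entries of
-- Â^t are at least 1/r and its columns sum to 1, every position is the leftmost support of at
-- most r rows. Moving e_t (with f_t(e_t) = 0) to the front reorders only the pairs {e_t, z}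
-- with z before e_t; such a z has f_t(z) = 0 (at most r of them) or forms an inversion with
-- e_t that the move removes. Replacing f_{t-1} by f_t creates at most r Σ_x |f_t(x) - f_{t-1}(x)|
-- inversions, and in every transportation flow the mass ≥ 1/r at the leftmost support of a row
-- travels at least that far, so this sum is at most r d_FR(Â^t, Â^{t-1}). Telescoping from
-- Φ_0 = 0 gives the bound with r² in place of 2r².

module Submission where

open import Defs
open import Algebra.Bundles using (CommutativeRing)
import Algebra.Properties.Semiring.Sum
open import Data.Bool using (if_then_else_; _xor_)
open import Data.Empty using (⊥-elim)
open import Level using (Level)
open import Data.Fin as F using (Fin; zero; suc; toℕ)
import Data.Fin.Properties as FP
open import Data.Fin.Permutation using (Permutation′; _⟨$⟩ʳ_; _⟨$⟩ˡ_; inverseˡ)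
open import Data.Fin.Subset using (Subset; ∣_∣)
import Data.Integer as ℤ
import Data.Integer.Properties as ℤP
open import Data.Nat as ℕ using (ℕ; zero; suc; z≤n; s≤s; _+_; _*_; _∸_; _≤_; _<_; NonZero)
import Data.Nat.Properties as NP
open import Data.Nat.Tactic.RingSolver using (solve-∀)
open import Data.Product using (Σ; ∃; _×_; _,_; proj₁; proj₂)
open import Data.Rational as ℚ using (ℚ; 0ℚ; 1ℚ; _/_; toℚᵘ)
import Data.Rational.Properties as ℚP
open import Data.Rational.Unnormalised as ℚᵘ using (mkℚᵘ; *≡*; *≤*)
import Data.Rational.Unnormalised.Properties as ℚᵘP
open import Data.Sum using (_⊎_; inj₁; inj₂)
open import Relation.Binary.PropositionalEquality
open import Relation.Nullary using (Dec; yes; no; does; ¬_)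
open import Relation.Nullary.Decidable using (dec-true; dec-false; _×-dec_; _⊎-dec_)

ℕ→ℚ≃ : ∀ k → toℚᵘ (ℕ→ℚ k) ℚᵘ.≃ mkℚᵘ (ℤ.+ k) 0
ℕ→ℚ≃ k = ℚP.toℚᵘ-fromℚᵘ (mkℚᵘ (ℤ.+ k) 0)

ℕ→ℚ-homo-+ : ∀ m n → ℕ→ℚ (m + n) ≡ ℕ→ℚ m ℚ.+ ℕ→ℚ n
ℕ→ℚ-homo-+ m n = ℚP.toℚᵘ-injective (begin
  toℚᵘ (ℕ→ℚ (m + n))                   ≈⟨ ℕ→ℚ≃ (m + n) ⟩
  mkℚᵘ (ℤ.+ (m + n)) 0                  ≈⟨ *≡* (cong (ℤ._* ℤ.1ℤ) eq) ⟩
  mkℚᵘ (ℤ.+ m) 0 ℚᵘ.+ mkℚᵘ (ℤ.+ n) 0    ≈⟨ ℚᵘP.+-cong (ℚᵘP.≃-sym (ℕ→ℚ≃ m)) (ℚᵘP.≃-sym (ℕ→ℚ≃ n)) ⟩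
  toℚᵘ (ℕ→ℚ m) ℚᵘ.+ toℚᵘ (ℕ→ℚ n)       ≈⟨ ℚᵘP.≃-sym (ℚP.toℚᵘ-homo-+ (ℕ→ℚ m) (ℕ→ℚ n)) ⟩
  toℚᵘ (ℕ→ℚ m ℚ.+ ℕ→ℚ n)               ∎)
  where
  open ℚᵘP.≃-Reasoning
  eq : ℤ.+ (m + n) ≡ (ℤ.+ m) ℤ.* ℤ.1ℤ ℤ.+ (ℤ.+ n) ℤ.* ℤ.1ℤ
  eq = trans (ℤP.pos-+ m n) (sym (cong₂ ℤ._+_ (ℤP.*-identityʳ (ℤ.+ m)) (ℤP.*-identityʳ (ℤ.+ n))))

ℕ→ℚ-homo-* : ∀ m n → ℕ→ℚ (m * n) ≡ ℕ→ℚ m ℚ.* ℕ→ℚ n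
ℕ→ℚ-homo-* m n = ℚP.toℚᵘ-injective (begin
  toℚᵘ (ℕ→ℚ (m * n))                   ≈⟨ ℕ→ℚ≃ (m * n) ⟩
  mkℚᵘ (ℤ.+ (m * n)) 0                  ≈⟨ *≡* (cong (ℤ._* ℤ.1ℤ) (ℤP.pos-* m n)) ⟩
  mkℚᵘ (ℤ.+ m) 0 ℚᵘ.* mkℚᵘ (ℤ.+ n) 0    ≈⟨ ℚᵘP.*-cong (ℚᵘP.≃-sym (ℕ→ℚ≃ m)) (ℚᵘP.≃-sym (ℕ→ℚ≃ n)) ⟩
  toℚᵘ (ℕ→ℚ m) ℚᵘ.* toℚᵘ (ℕ→ℚ n)       ≈⟨ ℚᵘP.≃-sym (ℚP.toℚᵘ-homo-* (ℕ→ℚ m) (ℕ→ℚ n)) ⟩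
  toℚᵘ (ℕ→ℚ m ℚ.* ℕ→ℚ n)               ∎)
  where open ℚᵘP.≃-Reasoning

ℕ→ℚ-mono-≤ : ∀ {m n} → m ≤ n → ℕ→ℚ m ℚ.≤ ℕ→ℚ n
ℕ→ℚ-mono-≤ {m} {n} m≤n = ℚP.toℚᵘ-cancel-≤
  (ℚᵘP.≤-respˡ-≃ (ℚᵘP.≃-sym (ℕ→ℚ≃ m)) (ℚᵘP.≤-respʳ-≃ (ℚᵘP.≃-sym (ℕ→ℚ≃ n))
    (*≤* (ℤP.*-monoʳ-≤-nonNeg (ℤ.+ 1) (ℤ.+≤+ m≤n)))))

ℕ→ℚ-cancel-≤ : ∀ {m n} → ℕ→ℚ m ℚ.≤ ℕ→ℚ n → m ≤ n
ℕ→ℚ-cancel-≤ {m} {n} p = ℤP.drop‿+≤+ (ℤP.*-cancelʳ-≤-pos (ℤ.+ m) (ℤ.+ n) (ℤ.+ 1)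
  (ℚᵘP.drop-*≤* (ℚᵘP.≤-respˡ-≃ (ℕ→ℚ≃ m) (ℚᵘP.≤-respʳ-≃ (ℕ→ℚ≃ n) (ℚP.toℚᵘ-mono-≤ p)))))

ℕ→ℚ-nonNeg : ∀ k → 0ℚ ℚ.≤ ℕ→ℚ k
ℕ→ℚ-nonNeg k = ℕ→ℚ-mono-≤ {0} {k} z≤n

k/r≡k*1/r : ∀ k r .{{_ : NonZero r}} → (ℤ.+ k) / r ≡ ℕ→ℚ k ℚ.* ((ℤ.+ 1) / r)
k/r≡k*1/r k (suc d) = ℚP.toℚᵘ-injective (begin
  toℚᵘ ((ℤ.+ k) / suc d)
    ≈⟨ ℚP.toℚᵘ-fromℚᵘ (mkℚᵘ (ℤ.+ k) d) ⟩
  mkℚᵘ (ℤ.+ k) d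
    ≈⟨ *≡* (cong₂ ℤ._*_ (sym (ℤP.*-identityʳ (ℤ.+ k))) (cong (λ x → ℤ.+ suc x) (NP.+-identityʳ d))) ⟩
  mkℚᵘ (ℤ.+ k) 0 ℚᵘ.* mkℚᵘ (ℤ.+ 1) d
    ≈⟨ ℚᵘP.*-cong (ℚᵘP.≃-sym (ℕ→ℚ≃ k)) (ℚᵘP.≃-sym (ℚP.toℚᵘ-fromℚᵘ (mkℚᵘ (ℤ.+ 1) d))) ⟩
  toℚᵘ (ℕ→ℚ k) ℚᵘ.* toℚᵘ ((ℤ.+ 1) / suc d)
    ≈⟨ ℚᵘP.≃-sym (ℚP.toℚᵘ-homo-* (ℕ→ℚ k) ((ℤ.+ 1) / suc d)) ⟩
  toℚᵘ (ℕ→ℚ k ℚ.* ((ℤ.+ 1) / suc d))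
    ∎)
  where open ℚᵘP.≃-Reasoning

r*1/r≡1 : ∀ r .{{_ : NonZero r}} → ℕ→ℚ r ℚ.* ((ℤ.+ 1) / r) ≡ 1ℚ
r*1/r≡1 r@(suc d) = trans (sym (k/r≡k*1/r r r)) (ℚP.toℚᵘ-injective
  (ℚᵘP.≃-trans (ℚP.toℚᵘ-fromℚᵘ (mkℚᵘ (ℤ.+ r) d)) (*≡* (ℤP.*-comm (ℤ.+ r) (ℤ.+ 1)))))

1/r-pos : ∀ r .{{_ : NonZero r}} → 0ℚ ℚ.< (ℤ.+ 1) / r
1/r-pos r = ℚP.positive⁻¹ _ {{ℚP.normalize-pos 1 r}}

module ℕΣ = Algebra.Properties.Semiring.Sum NP.+-*-semiring
module ℚΣ = Algebra.Properties.Semiring.Sum (CommutativeRing.semiring ℚP.+-*-commutativeRing)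

sumℕ≡∑ : ∀ {n} (f : Fin n → ℕ) → sumℕ f ≡ ℕΣ.sum f
sumℕ≡∑ {zero}  f = refl
sumℕ≡∑ {suc n} f = cong (f zero +_) (sumℕ≡∑ (λ i → f (suc i)))

sumℚ≡∑ : ∀ {n} (f : Fin n → ℚ) → sumℚ f ≡ ℚΣ.sum f
sumℚ≡∑ {zero}  f = refl
sumℚ≡∑ {suc n} f = cong (f zero ℚ.+_) (sumℚ≡∑ (λ i → f (suc i)))

sumℕ-cong : ∀ {n} {f g : Fin n → ℕ} → (∀ i → f i ≡ g i) → sumℕ f ≡ sumℕ g
sumℕ-cong {zero}  f≗g = refl
sumℕ-cong {suc n} f≗g = cong₂ _+_ (f≗g zero) (sumℕ-cong (λ i → f≗g (suc i)))

sumℕ-mono : ∀ {n} {f g : Fin n → ℕ} → (∀ i → f i ≤ g i) → sumℕ f ≤ sumℕ g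
sumℕ-mono {zero}  f≤g = z≤n
sumℕ-mono {suc n} f≤g = NP.+-mono-≤ (f≤g zero) (sumℕ-mono (λ i → f≤g (suc i)))

sumℕ-zero : ∀ n → sumℕ {n} (λ _ → 0) ≡ 0
sumℕ-zero n = trans (sumℕ≡∑ {n} (λ _ → 0)) (ℕΣ.sum-replicate-zero n)

sumℕ-distrib-+ : ∀ {n} (f g : Fin n → ℕ) → sumℕ (λ i → f i + g i) ≡ sumℕ f + sumℕ g
sumℕ-distrib-+ f g = begin
  sumℕ (λ i → f i + g i)      ≡⟨ sumℕ≡∑ (λ i → f i + g i) ⟩
  ℕΣ.sum (λ i → f i + g i)    ≡⟨ ℕΣ.∑-distrib-+ f g ⟩
  ℕΣ.sum f + ℕΣ.sum g         ≡⟨ cong₂ _+_ (sumℕ≡∑ f) (sumℕ≡∑ g) ⟨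
  sumℕ f + sumℕ g             ∎
  where open ≡-Reasoning

sumℕ-comm : ∀ {m n} (f : Fin m → Fin n → ℕ) →
            sumℕ (λ x → sumℕ (λ y → f x y)) ≡ sumℕ (λ y → sumℕ (λ x → f x y))
sumℕ-comm f = begin
  sumℕ (λ x → sumℕ (λ y → f x y))       ≡⟨ sumℕ-cong (λ x → sumℕ≡∑ (f x)) ⟩
  sumℕ (λ x → ℕΣ.sum (λ y → f x y))     ≡⟨ sumℕ≡∑ (λ x → ℕΣ.sum (f x)) ⟩
  ℕΣ.sum (λ x → ℕΣ.sum (λ y → f x y))   ≡⟨ ℕΣ.∑-comm f ⟩
  ℕΣ.sum (λ y → ℕΣ.sum (λ x → f x y))   ≡⟨ sumℕ≡∑ (λ y → ℕΣ.sum (λ x → f x y)) ⟨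
  sumℕ (λ y → ℕΣ.sum (λ x → f x y))     ≡⟨ sumℕ-cong (λ y → sumℕ≡∑ (λ x → f x y)) ⟨
  sumℕ (λ y → sumℕ (λ x → f x y))       ∎
  where open ≡-Reasoning

sumℕ²-distrib-+ : ∀ {m n} (f g : Fin m → Fin n → ℕ) →
                  sumℕ (λ x → sumℕ (λ y → f x y + g x y))
                  ≡ sumℕ (λ x → sumℕ (f x)) + sumℕ (λ x → sumℕ (g x))
sumℕ²-distrib-+ f g = trans (sumℕ-cong (λ x → sumℕ-distrib-+ (f x) (g x)))
  (sumℕ-distrib-+ (λ x → sumℕ (f x)) (λ x → sumℕ (g x)))

*-distribˡ-sumℕ : ∀ {n} c (f : Fin n → ℕ) → c * sumℕ f ≡ sumℕ (λ i → c * f i)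
*-distribˡ-sumℕ c f = trans (cong (c *_) (sumℕ≡∑ f))
  (trans (ℕΣ.*-distribˡ-sum c f) (sym (sumℕ≡∑ (λ i → c * f i))))

sumℕ-δ : ∀ {n} (e : Fin n) (h : Fin n → ℕ) →
         sumℕ (λ y → if does (y F.≟ e) then h y else 0) ≡ h e
sumℕ-δ {suc n} zero h = trans (cong (h zero +_) (sumℕ-zero n)) (NP.+-identityʳ (h zero))
sumℕ-δ {suc n} (suc e) h = trans (sumℕ-cong suc≟suc) (sumℕ-δ e (λ i → h (suc i)))
  where
  suc≟suc : ∀ i → (if does (suc i F.≟ suc e) then h (suc i) else 0)
                 ≡ (if does (i F.≟ e) then h (suc i) else 0)
  suc≟suc i with i F.≟ e
  ... | yes _ = refl
  ... | no  _ = refl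

sumℚ-cong : ∀ {n} {f g : Fin n → ℚ} → (∀ i → f i ≡ g i) → sumℚ f ≡ sumℚ g
sumℚ-cong {zero}  f≗g = refl
sumℚ-cong {suc n} f≗g = cong₂ ℚ._+_ (f≗g zero) (sumℚ-cong (λ i → f≗g (suc i)))

sumℚ-mono : ∀ {n} {f g : Fin n → ℚ} → (∀ i → f i ℚ.≤ g i) → sumℚ f ℚ.≤ sumℚ g
sumℚ-mono {zero}  f≤g = ℚP.≤-refl
sumℚ-mono {suc n} f≤g = ℚP.+-mono-≤ (f≤g zero) (sumℚ-mono (λ i → f≤g (suc i)))

sumℚ-zero : ∀ n → sumℚ {n} (λ _ → 0ℚ) ≡ 0ℚ
sumℚ-zero n = trans (sumℚ≡∑ {n} (λ _ → 0ℚ)) (ℚΣ.sum-replicate-zero n)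

sumℚ-nonNeg : ∀ {n} {f : Fin n → ℚ} → (∀ i → 0ℚ ℚ.≤ f i) → 0ℚ ℚ.≤ sumℚ f
sumℚ-nonNeg {n} {f} f≥0 = subst (ℚ._≤ sumℚ f) (sumℚ-zero n) (sumℚ-mono f≥0)

sumℚ-nonPos : ∀ {n} {f : Fin n → ℚ} → (∀ i → f i ℚ.≤ 0ℚ) → sumℚ f ℚ.≤ 0ℚ
sumℚ-nonPos {n} {f} f≤0 = subst (sumℚ f ℚ.≤_) (sumℚ-zero n) (sumℚ-mono f≤0)

term≤sumℚ : ∀ {n} {f : Fin n → ℚ} → (∀ i → 0ℚ ℚ.≤ f i) → ∀ k → f k ℚ.≤ sumℚ f
term≤sumℚ {suc n} {f} f≥0 zero = ℚP.≤-trans (ℚP.≤-reflexive (sym (ℚP.+-identityʳ (f zero))))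
  (ℚP.+-monoʳ-≤ (f zero) (sumℚ-nonNeg (λ i → f≥0 (suc i))))
term≤sumℚ {suc n} {f} f≥0 (suc k) = ℚP.≤-trans (term≤sumℚ (λ i → f≥0 (suc i)) k)
  (ℚP.≤-trans (ℚP.≤-reflexive (sym (ℚP.+-identityˡ _))) (ℚP.+-monoˡ-≤ _ (f≥0 zero)))

*-distribˡ-sumℚ : ∀ {n} c (f : Fin n → ℚ) → c ℚ.* sumℚ f ≡ sumℚ (λ i → c ℚ.* f i)
*-distribˡ-sumℚ c f = trans (cong (c ℚ.*_) (sumℚ≡∑ f))
  (trans (ℚΣ.*-distribˡ-sum c f) (sym (sumℚ≡∑ (λ i → c ℚ.* f i))))

ℕ→ℚ-sumℕ : ∀ {n} (f : Fin n → ℕ) → ℕ→ℚ (sumℕ f) ≡ sumℚ (λ i → ℕ→ℚ (f i))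
ℕ→ℚ-sumℕ {zero}  f = refl
ℕ→ℚ-sumℕ {suc n} f = trans (ℕ→ℚ-homo-+ (f zero) (sumℕ (λ i → f (suc i))))
                           (cong (ℕ→ℚ (f zero) ℚ.+_) (ℕ→ℚ-sumℕ (λ i → f (suc i))))

𝟙 : ∀ {p} {P : Set p} → Dec P → ℕ
𝟙 P? = if does P? then 1 else 0

private
  variable
    ℓ ℓ′ ℓ″ : Level
    P : Set ℓ
    Q : Set ℓ′
    R : Set ℓ″
    C S : Set ℓ

𝟙-no : (P? : Dec P) → ¬ P → 𝟙 P? ≡ 0
𝟙-no P? ¬p rewrite dec-false P? ¬p = refl

𝟙-mono : (P → Q) → (P? : Dec P) (Q? : Dec Q) → 𝟙 P? ≤ 𝟙 Q?
𝟙-mono P⇒Q (yes p) (yes q) = NP.≤-refl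
𝟙-mono P⇒Q (yes p) (no ¬q) = ⊥-elim (¬q (P⇒Q p))
𝟙-mono P⇒Q (no ¬p) Q?      = z≤n

𝟙-≤-+ : (P → Q ⊎ R) → (P? : Dec P) (Q? : Dec Q) (R? : Dec R) → 𝟙 P? ≤ 𝟙 Q? + 𝟙 R?
𝟙-≤-+ P⇒Q⊎R (no ¬p) Q? R? = z≤n
𝟙-≤-+ P⇒Q⊎R (yes p) Q? R? with P⇒Q⊎R p
... | inj₁ q = NP.≤-trans (𝟙-mono (λ _ → q) (yes p) Q?) (NP.m≤m+n (𝟙 Q?) (𝟙 R?))
... | inj₂ r = NP.≤-trans (𝟙-mono (λ _ → r) (yes p) R?) (NP.m≤n+m (𝟙 R?) (𝟙 Q?))

𝟙-+-≤ : (Q → P) → (R → P) → (Q → ¬ R) → (P? : Dec P) (Q? : Dec Q) (R? : Dec R) →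
        𝟙 Q? + 𝟙 R? ≤ 𝟙 P?
𝟙-+-≤ Q⇒P R⇒P Q∩R=∅ P? (yes q) (yes r) = ⊥-elim (Q∩R=∅ q r)
𝟙-+-≤ Q⇒P R⇒P Q∩R=∅ P? (yes q) (no ¬r) =
  NP.≤-trans (NP.≤-reflexive (NP.+-identityʳ 1)) (𝟙-mono Q⇒P (yes q) P?)
𝟙-+-≤ Q⇒P R⇒P Q∩R=∅ P? (no ¬q) R?      = 𝟙-mono R⇒P R? P?

𝟙-×-dec : (P? : Dec P) (Q? : Dec Q) → 𝟙 (P? ×-dec Q?) ≡ (if does P? then 𝟙 Q? else 0)
𝟙-×-dec (yes p) Q? = refl
𝟙-×-dec (no ¬p) Q? = refl

sumℕ-𝟙-≡ : ∀ {n q} {Q : Fin n → Set q} (e : Fin n) (Q? : ∀ y → Dec (Q y)) →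
           sumℕ (λ y → 𝟙 ((y F.≟ e) ×-dec Q? y)) ≡ 𝟙 (Q? e)
sumℕ-𝟙-≡ e Q? = trans (sumℕ-cong (λ y → 𝟙-×-dec (y F.≟ e) (Q? y))) (sumℕ-δ e (λ y → 𝟙 (Q? y)))

sumℕ-𝟙-none : ∀ {n q} {Q : Fin n → Set q} (Q? : ∀ y → Dec (Q y)) → (∀ y → ¬ Q y) →
               sumℕ (λ y → 𝟙 (Q? y)) ≡ 0
sumℕ-𝟙-none {n} Q? ¬Q = trans (sumℕ-cong (λ y → 𝟙-no (Q? y) (¬Q y))) (sumℕ-zero n)

disagreement≤ : (C? : Dec C) (P? : Dec P) (Q? : Dec Q) (R? : Dec R) (S? : Dec S) →
                (C → P → ¬ Q → R ⊎ S) → (C → ¬ P → Q → R ⊎ S) →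
                (if does C? then (if does P? xor does Q? then 1 else 0) else 0) ≤ 𝟙 R? + 𝟙 S?
disagreement≤ (no ¬c) P? Q? R? S? _ _ = z≤n
disagreement≤ (yes c) (yes p) (yes q) R? S? _ _ = z≤n
disagreement≤ (yes c) (no ¬p) (no ¬q) R? S? _ _ = z≤n
disagreement≤ (yes c) (yes p) (no ¬q) R? S? P¬Q _ = 𝟙-≤-+ (λ c → P¬Q c p ¬q) (yes c) R? S?
disagreement≤ (yes c) (no ¬p) (yes q) R? S? _ ¬PQ = 𝟙-≤-+ (λ c → ¬PQ c ¬p q) (yes c) R? S?

-- Inversions and move-to-front

pos : ∀ {n} → Permutation′ n → Fin n → ℕ
pos π x = toℕ (π ⟨$⟩ʳ x)

pos-injective : ∀ {n} (π : Permutation′ n) {x y} → pos π x ≡ pos π y → x ≡ y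
pos-injective π {x} {y} eq = begin
  x                        ≡⟨ inverseˡ π ⟨
  π ⟨$⟩ˡ (π ⟨$⟩ʳ x)        ≡⟨ cong (π ⟨$⟩ˡ_) (FP.toℕ-injective eq) ⟩
  π ⟨$⟩ˡ (π ⟨$⟩ʳ y)        ≡⟨ inverseˡ π ⟩
  y                        ∎
  where open ≡-Reasoning

pos-≮⇒> : ∀ {n} (π : Permutation′ n) {x y} → x ≢ y → ¬ pos π x < pos π y → pos π y < pos π x
pos-≮⇒> π x≢y x≮y = NP.≤∧≢⇒< (NP.≮⇒≥ x≮y) (λ eq → x≢y (pos-injective π (sym eq)))

Inverted : ∀ {n} → Permutation′ n → (Fin n → ℕ) → Fin n → Fin n → Set
Inverted π f x y = pos π x < pos π y × f y < f x

inverted? : ∀ {n} (π : Permutation′ n) (f : Fin n → ℕ) x y → Dec (Inverted π f x y)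
inverted? π f x y = (π ⟨$⟩ʳ x F.<? π ⟨$⟩ʳ y) ×-dec (f y ℕ.<? f x)

inversions : ∀ {n} → Permutation′ n → (Fin n → ℕ) → ℕ
inversions π f = sumℕ λ x → sumℕ λ y → 𝟙 (inverted? π f x y)

inversions-self : ∀ {n} (π : Permutation′ n) {f : Fin n → ℕ} → (∀ x → f x ≡ pos π x) → inversions π f ≡ 0
inversions-self {n} π {f} f≗pos = trans (sumℕ-cong (λ x → sumℕ-𝟙-none (inverted? π f x)
  (λ y (x<y , fy<fx) → NP.<-asym x<y (subst₂ _<_ (f≗pos y) (f≗pos x) fy<fx)))) (sumℕ-zero n)

module MoveToFront-properties {n} {π σ : Permutation′ n} {e : Fin n} (mtf : MoveToFront π e σ) where

  moved-first : pos σ e ≡ 0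
  moved-first with mtf e
  ... | σe rewrite dec-true (e F.≟ e) refl = σe

  shifted : ∀ {x} → x ≢ e → pos π x < pos π e → pos σ x ≡ suc (pos π x)
  shifted {x} x≢e x<e with mtf x
  ... | σx rewrite dec-false (x F.≟ e) x≢e | dec-true (π ⟨$⟩ʳ x F.<? π ⟨$⟩ʳ e) x<e = σx

  unshifted : ∀ {x} → x ≢ e → ¬ pos π x < pos π e → pos σ x ≡ pos π x
  unshifted {x} x≢e x≮e with mtf x
  ... | σx rewrite dec-false (x F.≟ e) x≢e | dec-false (π ⟨$⟩ʳ x F.<? π ⟨$⟩ʳ e) x≮e = σx

  moved-before : ∀ {x} → x ≢ e → pos σ e < pos σ x
  moved-before {x} x≢e rewrite moved-first with pos π x ℕ.<? pos π e
  ... | yes x<e rewrite shifted x≢e x<e = s≤s z≤n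
  ... | no  x≮e rewrite unshifted x≢e x≮e = NP.≤-<-trans z≤n (pos-≮⇒> π x≢e x≮e)

  nothing-before-moved : ∀ {x} → ¬ pos σ x < pos σ e
  nothing-before-moved {x} x<e = NP.n≮0 (subst (pos σ x <_) moved-first x<e)

  preserves-order : ∀ {x y} → x ≢ e → y ≢ e → pos π x < pos π y → pos σ x < pos σ y
  preserves-order {x} {y} x≢e y≢e x<y with pos π x ℕ.<? pos π e | pos π y ℕ.<? pos π e
  ... | yes x<e | yes y<e rewrite shifted x≢e x<e | shifted y≢e y<e = s≤s x<y
  ... | yes x<e | no  y≮e rewrite shifted x≢e x<e | unshifted y≢e y≮e = NP.≤-<-trans x<e (pos-≮⇒> π y≢e y≮e)
  ... | no  x≮e | yes y<e = ⊥-elim (NP.<-asym (NP.<-trans x<y y<e) (pos-≮⇒> π x≢e x≮e))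
  ... | no  x≮e | no  y≮e rewrite unshifted x≢e x≮e | unshifted y≢e y≮e = x<y

  reflects-order : ∀ {x y} → x ≢ e → y ≢ e → pos σ x < pos σ y → pos π x < pos π y
  reflects-order {x} {y} x≢e y≢e σx<σy with pos π y ℕ.<? pos π x
  ... | yes y<x = ⊥-elim (NP.<-asym σx<σy (preserves-order y≢e x≢e y<x))
  ... | no  y≮x = pos-≮⇒> π (λ y≡x → NP.<-irrefl (cong (pos σ) (sym y≡x)) σx<σy) y≮x

  EarlierThanMoved : Fin n → Set
  EarlierThanMoved x = pos π x < pos π e

  -- dKT counts a pair once, as x < y in the element order; the move reorders only pairs
  -- containing e, which is the smaller element in Flip₁ and the larger one in Flip₂.
  Flip₁ Flip₂ : Fin n → Fin n → Set
  Flip₁ x y = x ≡ e × (EarlierThanMoved y × x F.< y)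
  Flip₂ x y = y ≡ e × (EarlierThanMoved x × x F.< y)

  flip₁? : ∀ x y → Dec (Flip₁ x y)
  flip₁? x y = (x F.≟ e) ×-dec ((π ⟨$⟩ʳ y F.<? π ⟨$⟩ʳ e) ×-dec (x F.<? y))
  flip₂? : ∀ x y → Dec (Flip₂ x y)
  flip₂? x y = (y F.≟ e) ×-dec ((π ⟨$⟩ʳ x F.<? π ⟨$⟩ʳ e) ×-dec (x F.<? y))

  flip-forward : ∀ {x y} → x F.< y → pos σ x < pos σ y → ¬ pos π x < pos π y → Flip₁ x y ⊎ Flip₂ x y
  flip-forward {x} {y} x<y σx<σy πx≮πy with x F.≟ e | y F.≟ e
  ... | yes refl | _      = inj₁ (refl , pos-≮⇒> π (λ x≡y → FP.<-irrefl x≡y x<y) πx≮πy , x<y)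
  ... | no  x≢e | yes refl = ⊥-elim (nothing-before-moved σx<σy)
  ... | no  x≢e | no  y≢e = ⊥-elim (πx≮πy (reflects-order x≢e y≢e σx<σy))

  flip-backward : ∀ {x y} → x F.< y → ¬ pos σ x < pos σ y → pos π x < pos π y → Flip₁ x y ⊎ Flip₂ x y
  flip-backward {x} {y} x<y σx≮σy πx<πy with x F.≟ e | y F.≟ e
  ... | yes refl | _       = ⊥-elim (σx≮σy (moved-before (λ y≡x → FP.<-irrefl (sym y≡x) x<y)))
  ... | no  x≢e | yes refl = inj₂ (refl , πx<πy , x<y)
  ... | no  x≢e | no  y≢e = ⊥-elim (σx≮σy (preserves-order x≢e y≢e πx<πy))

  dKT-moveToFront : dKT σ π ≤ sumℕ (λ x → 𝟙 (π ⟨$⟩ʳ x F.<? π ⟨$⟩ʳ e))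
  dKT-moveToFront = begin
    dKT σ π
      ≤⟨ sumℕ-mono (λ x → sumℕ-mono (λ y → disagreement≤ (x F.<? y) (σ ⟨$⟩ʳ x F.<? σ ⟨$⟩ʳ y)
           (π ⟨$⟩ʳ x F.<? π ⟨$⟩ʳ y) (flip₁? x y) (flip₂? x y) flip-forward flip-backward)) ⟩
    sumℕ (λ x → sumℕ (λ y → 𝟙 (flip₁? x y) + 𝟙 (flip₂? x y)))
      ≡⟨ sumℕ²-distrib-+ (λ x y → 𝟙 (flip₁? x y)) (λ x y → 𝟙 (flip₂? x y)) ⟩
    sumℕ (λ x → sumℕ (λ y → 𝟙 (flip₁? x y))) + sumℕ (λ x → sumℕ (λ y → 𝟙 (flip₂? x y)))
      ≡⟨ cong₂ _+_ (trans (sumℕ-comm (λ x y → 𝟙 (flip₁? x y)))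
                          (sumℕ-cong (λ y → sumℕ-𝟙-≡ e (λ x → (π ⟨$⟩ʳ y F.<? π ⟨$⟩ʳ e) ×-dec (x F.<? y)))))
                   (sumℕ-cong (λ x → sumℕ-𝟙-≡ e (λ y → (π ⟨$⟩ʳ x F.<? π ⟨$⟩ʳ e) ×-dec (x F.<? y)))) ⟩
    sumℕ (λ z → 𝟙 (after z)) + sumℕ (λ z → 𝟙 (before z))
      ≡⟨ sumℕ-distrib-+ (λ z → 𝟙 (after z)) (λ z → 𝟙 (before z)) ⟨
    sumℕ (λ z → 𝟙 (after z) + 𝟙 (before z))
      ≤⟨ sumℕ-mono (λ z → 𝟙-+-≤ proj₁ proj₁ (λ (_ , e<z) (_ , z<e) → NP.<-asym e<z z<e)
                                (π ⟨$⟩ʳ z F.<? π ⟨$⟩ʳ e) (after z) (before z)) ⟩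
    sumℕ (λ z → 𝟙 (π ⟨$⟩ʳ z F.<? π ⟨$⟩ʳ e)) ∎
    where
    open NP.≤-Reasoning
    after : ∀ z → Dec (EarlierThanMoved z × e F.< z)
    after z = (π ⟨$⟩ʳ z F.<? π ⟨$⟩ʳ e) ×-dec (e F.<? z)
    before : ∀ z → Dec (EarlierThanMoved z × z F.< e)
    before z = (π ⟨$⟩ʳ z F.<? π ⟨$⟩ʳ e) ×-dec (z F.<? e)

  module _ (f : Fin n → ℕ) (fe≡0 : f e ≡ 0) where

    inverted-preserved : ∀ {x y} → Inverted σ f x y → Inverted π f x y
    inverted-preserved {x} {y} (σx<σy , fy<fx) with x F.≟ e | y F.≟ e
    ... | yes refl | _       = ⊥-elim (NP.n≮0 (subst (f y <_) fe≡0 fy<fx))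
    ... | no  x≢e | yes refl = ⊥-elim (nothing-before-moved σx<σy)
    ... | no  x≢e | no  y≢e = reflects-order x≢e y≢e σx<σy , fy<fx

    inversions-row : ∀ x → sumℕ (λ y → 𝟙 (inverted? σ f x y)) + 𝟙 (inverted? π f x e)
                         ≤ sumℕ (λ y → 𝟙 (inverted? π f x y))
    inversions-row x = begin
      sumℕ (λ y → 𝟙 (inverted? σ f x y)) + 𝟙 (inverted? π f x e)
        ≡⟨ cong (sumℕ (λ y → 𝟙 (inverted? σ f x y)) +_) (sumℕ-𝟙-≡ e (inverted? π f x)) ⟨
      sumℕ (λ y → 𝟙 (inverted? σ f x y)) + sumℕ (λ y → 𝟙 ((y F.≟ e) ×-dec inverted? π f x y))
        ≡⟨ sumℕ-distrib-+ (λ y → 𝟙 (inverted? σ f x y)) (λ y → 𝟙 ((y F.≟ e) ×-dec inverted? π f x y)) ⟨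
      sumℕ (λ y → 𝟙 (inverted? σ f x y) + 𝟙 ((y F.≟ e) ×-dec inverted? π f x y))
        ≤⟨ sumℕ-mono (λ y → 𝟙-+-≤ inverted-preserved proj₂
             (λ (σx<σy , _) (y≡e , _) → nothing-before-moved (subst (λ z → pos σ x < pos σ z) y≡e σx<σy))
             (inverted? π f x y) (inverted? σ f x y) ((y F.≟ e) ×-dec inverted? π f x y)) ⟩
      sumℕ (λ y → 𝟙 (inverted? π f x y)) ∎
      where open NP.≤-Reasoning

    earlier-inverted-or-zero : ∀ x → EarlierThanMoved x → Inverted π f x e ⊎ f x ≡ 0
    earlier-inverted-or-zero x x<e with f x ℕ.≟ 0
    ... | yes fx≡0 = inj₂ fx≡0
    ... | no  fx≢0 = inj₁ (x<e , subst (_< f x) (sym fe≡0) (NP.n≢0⇒n>0 fx≢0))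

    dKT+inversions-moveToFront : dKT σ π + inversions σ f ≤ inversions π f + sumℕ (λ x → 𝟙 (f x ℕ.≟ 0))
    dKT+inversions-moveToFront = begin
      dKT σ π + inversions σ f
        ≤⟨ NP.+-monoˡ-≤ (inversions σ f) (NP.≤-trans dKT-moveToFront (sumℕ-mono (λ x →
             𝟙-≤-+ (earlier-inverted-or-zero x) (π ⟨$⟩ʳ x F.<? π ⟨$⟩ʳ e) (inverted? π f x e) (f x ℕ.≟ 0)))) ⟩
      sumℕ (λ x → 𝟙 (inverted? π f x e) + 𝟙 (f x ℕ.≟ 0)) + inversions σ f
        ≡⟨ cong (_+ inversions σ f) (sumℕ-distrib-+ (λ x → 𝟙 (inverted? π f x e)) (λ x → 𝟙 (f x ℕ.≟ 0))) ⟩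
      (sumℕ (λ x → 𝟙 (inverted? π f x e)) + zeros) + inversions σ f
        ≡⟨ rearrange (sumℕ (λ x → 𝟙 (inverted? π f x e))) zeros (inversions σ f) ⟩
      (inversions σ f + sumℕ (λ x → 𝟙 (inverted? π f x e))) + zeros
        ≡⟨ cong (_+ zeros) (sumℕ-distrib-+ (λ x → sumℕ (λ y → 𝟙 (inverted? σ f x y)))
                                           (λ x → 𝟙 (inverted? π f x e))) ⟨
      sumℕ (λ x → sumℕ (λ y → 𝟙 (inverted? σ f x y)) + 𝟙 (inverted? π f x e)) + zeros
        ≤⟨ NP.+-monoˡ-≤ zeros (sumℕ-mono inversions-row) ⟩
      inversions π f + zeros ∎
      where
      open NP.≤-Reasoning
      zeros : ℕ
      zeros = sumℕ (λ x → 𝟙 (f x ℕ.≟ 0))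
      rearrange : ∀ a z b → (a + z) + b ≡ (b + a) + z
      rearrange = solve-∀

-- Changing the reference function of the inversion count

FibresAtMost : ∀ {n} → ℕ → (Fin n → ℕ) → Set
FibresAtMost r f = ∀ i → sumℕ (λ y → 𝟙 (f y ℕ.≟ i)) ≤ r

count-in-interval : ∀ {n r} {f : Fin n → ℕ} → FibresAtMost r f → ∀ a b →
                    sumℕ (λ y → 𝟙 ((a ℕ.≤? f y) ×-dec (f y ℕ.<? b))) ≤ r * (b ∸ a)
count-in-interval {f = f} fib a zero = NP.≤-trans
  (NP.≤-reflexive (sumℕ-𝟙-none (λ y → (a ℕ.≤? f y) ×-dec (f y ℕ.<? 0)) (λ y (_ , fy<0) → NP.n≮0 fy<0)))
  z≤n
count-in-interval {r = r} {f} fib a (suc b) with a ℕ.≤? b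
... | no a≰b = NP.≤-trans
  (NP.≤-reflexive (sumℕ-𝟙-none (λ y → (a ℕ.≤? f y) ×-dec (f y ℕ.<? suc b))
    (λ y (a≤fy , fy<1+b) → a≰b (NP.≤-trans a≤fy (NP.≤-pred fy<1+b)))))
  z≤n
... | yes a≤b = begin
  sumℕ (λ y → 𝟙 ((a ℕ.≤? f y) ×-dec (f y ℕ.<? suc b)))
    ≤⟨ sumℕ-mono (λ y → 𝟙-≤-+ split ((a ℕ.≤? f y) ×-dec (f y ℕ.<? suc b))
                                ((a ℕ.≤? f y) ×-dec (f y ℕ.<? b)) (f y ℕ.≟ b)) ⟩
  sumℕ (λ y → 𝟙 ((a ℕ.≤? f y) ×-dec (f y ℕ.<? b)) + 𝟙 (f y ℕ.≟ b))
    ≡⟨ sumℕ-distrib-+ (λ y → 𝟙 ((a ℕ.≤? f y) ×-dec (f y ℕ.<? b))) (λ y → 𝟙 (f y ℕ.≟ b)) ⟩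
  sumℕ (λ y → 𝟙 ((a ℕ.≤? f y) ×-dec (f y ℕ.<? b))) + sumℕ (λ y → 𝟙 (f y ℕ.≟ b))
    ≤⟨ NP.+-mono-≤ (count-in-interval {f = f} fib a b) (fib b) ⟩
  r * (b ∸ a) + r
    ≡⟨ trans (NP.+-comm (r * (b ∸ a)) r) (sym (NP.*-suc r (b ∸ a))) ⟩
  r * suc (b ∸ a)
    ≡⟨ cong (r *_) (NP.+-∸-assoc 1 a≤b) ⟨
  r * (suc b ∸ a) ∎
  where
  open NP.≤-Reasoning
  split : ∀ {y} → a ≤ f y × f y < suc b → (a ≤ f y × f y < b) ⊎ f y ≡ b
  split {y} (a≤fy , fy<1+b) with f y ℕ.<? b
  ... | yes fy<b = inj₁ (a≤fy , fy<b)
  ... | no  fy≮b = inj₂ (NP.≤-antisym (NP.≤-pred fy<1+b) (NP.≮⇒≥ fy≮b))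

∣-∣≡∸+∸ : ∀ m n → ℕ.∣ m - n ∣ ≡ (m ∸ n) + (n ∸ m)
∣-∣≡∸+∸ zero    zero    = refl
∣-∣≡∸+∸ zero    (suc n) = refl
∣-∣≡∸+∸ (suc m) zero    = sym (NP.+-identityʳ (suc m))
∣-∣≡∸+∸ (suc m) (suc n) = ∣-∣≡∸+∸ m n

inversions-change : ∀ {n r} (π : Permutation′ n) {f g : Fin n → ℕ} →
                    FibresAtMost r f → FibresAtMost r g →
                    inversions π g ≤ inversions π f + r * sumℕ (λ x → ℕ.∣ g x - f x ∣)
inversions-change {n} {r} π {f} {g} fib-f fib-g = begin
  inversions π g
    ≤⟨ sumℕ-mono (λ x → sumℕ-mono (λ y → NP.≤-trans
         (𝟙-≤-+ (cases x y) (inverted? π g x y) (inverted? π f x y) (I₁? x y ⊎-dec I₂? x y))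
         (NP.+-monoʳ-≤ (𝟙 (inverted? π f x y)) (𝟙-≤-+ (λ i → i) (I₁? x y ⊎-dec I₂? x y) (I₁? x y) (I₂? x y))))) ⟩
  sumℕ (λ x → sumℕ (λ y → 𝟙 (inverted? π f x y) + (𝟙 (I₁? x y) + 𝟙 (I₂? x y))))
    ≡⟨ sumℕ²-distrib-+ (λ x y → 𝟙 (inverted? π f x y)) (λ x y → 𝟙 (I₁? x y) + 𝟙 (I₂? x y)) ⟩
  inversions π f + sumℕ (λ x → sumℕ (λ y → 𝟙 (I₁? x y) + 𝟙 (I₂? x y)))
    ≡⟨ cong (inversions π f +_) (sumℕ²-distrib-+ (λ x y → 𝟙 (I₁? x y)) (λ x y → 𝟙 (I₂? x y))) ⟩
  inversions π f + (sumℕ (λ x → sumℕ (λ y → 𝟙 (I₁? x y))) + sumℕ (λ x → sumℕ (λ y → 𝟙 (I₂? x y))))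
    ≡⟨ cong (λ s → inversions π f + (sumℕ (λ x → sumℕ (λ y → 𝟙 (I₁? x y))) + s)) (sumℕ-comm (λ x y → 𝟙 (I₂? x y))) ⟩
  inversions π f + (sumℕ (λ x → sumℕ (λ y → 𝟙 (I₁? x y))) + sumℕ (λ y → sumℕ (λ x → 𝟙 (I₂? x y))))
    ≤⟨ NP.+-monoʳ-≤ (inversions π f) (NP.+-mono-≤
         (sumℕ-mono (λ x → count-in-interval {f = f} fib-f (f x) (g x)))
         (sumℕ-mono (λ y → count-in-interval {f = g} fib-g (suc (g y)) (suc (f y))))) ⟩
  inversions π f + (sumℕ (λ x → r * (g x ∸ f x)) + sumℕ (λ x → r * (f x ∸ g x)))
    ≡⟨ cong (inversions π f +_) (begin-equality
         sumℕ (λ x → r * (g x ∸ f x)) + sumℕ (λ x → r * (f x ∸ g x))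
           ≡⟨ sumℕ-distrib-+ (λ x → r * (g x ∸ f x)) (λ x → r * (f x ∸ g x)) ⟨
         sumℕ (λ x → r * (g x ∸ f x) + r * (f x ∸ g x))
           ≡⟨ sumℕ-cong (λ x → trans (sym (NP.*-distribˡ-+ r (g x ∸ f x) (f x ∸ g x)))
                                      (cong (r *_) (sym (∣-∣≡∸+∸ (g x) (f x))))) ⟩
         sumℕ (λ x → r * ℕ.∣ g x - f x ∣)
           ≡⟨ *-distribˡ-sumℕ r (λ x → ℕ.∣ g x - f x ∣) ⟨
         r * sumℕ (λ x → ℕ.∣ g x - f x ∣) ∎) ⟩
  inversions π f + r * sumℕ (λ x → ℕ.∣ g x - f x ∣) ∎
  where
  open NP.≤-Reasoning
  I₁? : ∀ x y → Dec (f x ≤ f y × f y < g x)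
  I₁? x y = (f x ℕ.≤? f y) ×-dec (f y ℕ.<? g x)
  I₂? : ∀ x y → Dec (suc (g y) ≤ g x × g x < suc (f y))
  I₂? x y = (suc (g y) ℕ.≤? g x) ×-dec (g x ℕ.<? suc (f y))
  -- An inversion for g but not for f is charged to y if f y ∈ [f x, g x), and to x otherwise.
  cases : ∀ x y → Inverted π g x y →
          Inverted π f x y ⊎ ((f x ≤ f y × f y < g x) ⊎ (suc (g y) ≤ g x × g x < suc (f y)))
  cases x y (x<y , gy<gx) with f y ℕ.<? f x | f y ℕ.<? g x
  ... | yes fy<fx | _        = inj₁ (x<y , fy<fx)
  ... | no  fy≮fx | yes fy<gx = inj₂ (inj₁ (NP.≮⇒≥ fy≮fx , fy<gx))
  ... | no  fy≮fx | no  fy≮gx = inj₂ (inj₂ (gy<gx , s≤s (NP.≮⇒≥ fy≮gx)))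

-- Granular matrices and the leftmost supports of their rows

-- The properties of the reference matrices Â^t that the argument uses.
record Granular (r : ℕ) .{{_ : NonZero r}} {n} (M : Matrix n) : Set where
  field
    nonNeg         : ∀ x i → 0ℚ ℚ.≤ M x i
    row-support    : ∀ x → ∃ λ i → 0ℚ ℚ.< M x i
    positive⇒≥1/r  : ∀ x i → 0ℚ ℚ.< M x i → (ℤ.+ 1) / r ℚ.≤ M x i
    column-support : ∀ i → sumℕ (λ x → 𝟙 (0ℚ ℚP.<? M x i)) ≤ r

-- n when no entry is positive.
leftmost : ∀ {n} → (Fin n → ℚ) → ℕ
leftmost {zero}  w = 0
leftmost {suc n} w with 0ℚ ℚP.<? w zero
... | yes _ = 0
... | no  _ = suc (leftmost (λ i → w (suc i)))

leftmost-attained : ∀ {n} (w : Fin n → ℚ) {i} → 0ℚ ℚ.< w i →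
                    Σ (Fin n) λ k → toℕ k ≡ leftmost w × 0ℚ ℚ.< w k
leftmost-attained {suc n} w {i} wi>0 with 0ℚ ℚP.<? w zero | i
... | yes w₀>0 | _     = zero , refl , w₀>0
... | no  w₀≯0 | zero  = ⊥-elim (w₀≯0 wi>0)
... | no  w₀≯0 | suc i with leftmost-attained (λ j → w (suc j)) wi>0
...   | k , k≡ , wk>0 = suc k , cong suc k≡ , wk>0

leftmost-minimal : ∀ {n} (w : Fin n → ℚ) j → toℕ j < leftmost w → ¬ 0ℚ ℚ.< w j
leftmost-minimal {suc n} w j j<l with 0ℚ ℚP.<? w zero
leftmost-minimal {suc n} w zero    j<l       | no w₀≯0 = w₀≯0
leftmost-minimal {suc n} w (suc j) (s≤s j<l) | no w₀≯0 = leftmost-minimal (λ i → w (suc i)) j j<l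

module Granular-leftmost {r} .{{_ : NonZero r}} {n} {M : Matrix n} (gran : Granular r M) where
  open Granular gran

  leftmost-column : ∀ x → Σ (Fin n) λ k → toℕ k ≡ leftmost (M x) × (ℤ.+ 1) / r ℚ.≤ M x k
  leftmost-column x with leftmost-attained (M x) (proj₂ (row-support x))
  ... | k , k≡ , Mxk>0 = k , k≡ , positive⇒≥1/r x k Mxk>0

  before-leftmost : ∀ x j → toℕ j < leftmost (M x) → M x j ℚ.≤ 0ℚ
  before-leftmost x j j<l = ℚP.≮⇒≥ (leftmost-minimal (M x) j j<l)

  leftmost<n : ∀ x → leftmost (M x) < n
  leftmost<n x with leftmost-attained (M x) (proj₂ (row-support x))
  ... | k , k≡ , _ = subst (_< n) k≡ (FP.toℕ<n k)

  leftmost-fibres : FibresAtMost r (λ x → leftmost (M x))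
  leftmost-fibres i with i ℕ.<? n
  ... | no  i≮n = NP.≤-trans (NP.≤-reflexive (sumℕ-𝟙-none (λ x → leftmost (M x) ℕ.≟ i)
                    (λ x l≡i → i≮n (subst (_< n) l≡i (leftmost<n x))))) z≤n
  ... | yes i<n = NP.≤-trans (sumℕ-mono (λ x → 𝟙-mono (at-i x) (leftmost (M x) ℕ.≟ i) (0ℚ ℚP.<? M x k)))
                             (column-support k)
    where
    k : Fin n
    k = F.fromℕ< i<n
    at-i : ∀ x → leftmost (M x) ≡ i → 0ℚ ℚ.< M x k
    at-i x l≡i with leftmost-attained (M x) (proj₂ (row-support x))
    ... | k′ , k′≡ , Mxk′>0 =
      subst (λ j → 0ℚ ℚ.< M x j) (FP.toℕ-injective (trans k′≡ (trans l≡i (sym (FP.toℕ-fromℕ< i<n))))) Mxk′>0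

positive-multiple⇒≥1/r : ∀ r .{{_ : NonZero r}} k → 0ℚ ℚ.< (ℤ.+ k) / r → (ℤ.+ 1) / r ℚ.≤ (ℤ.+ k) / r
positive-multiple⇒≥1/r r zero    0<0/r = ⊥-elim (ℚP.<-irrefl refl
  (subst (0ℚ ℚ.<_) (trans (k/r≡k*1/r 0 r) (ℚP.*-zeroˡ ((ℤ.+ 1) / r))) 0<0/r))
positive-multiple⇒≥1/r r (suc k) _ = subst₂ ℚ._≤_ (ℚP.*-identityˡ ((ℤ.+ 1) / r)) (sym (k/r≡k*1/r (suc k) r))
  (ℚP.*-monoʳ-≤-nonNeg ((ℤ.+ 1) / r) {{ℚ.nonNegative (ℚP.<⇒≤ (1/r-pos r))}} (ℕ→ℚ-mono-≤ {1} {suc k} (s≤s z≤n)))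

count-positive*lower≤sum : ∀ {n} (w : Fin n → ℚ) {u} → (∀ x → 0ℚ ℚ.≤ w x) → (∀ x → 0ℚ ℚ.< w x → u ℚ.≤ w x) →
                           ℕ→ℚ (sumℕ (λ x → 𝟙 (0ℚ ℚP.<? w x))) ℚ.* u ℚ.≤ sumℚ w
count-positive*lower≤sum w {u} w≥0 w>0⇒≥u = begin
  ℕ→ℚ (sumℕ (λ x → 𝟙 (0ℚ ℚP.<? w x))) ℚ.* u
    ≡⟨ cong (ℚ._* u) (ℕ→ℚ-sumℕ (λ x → 𝟙 (0ℚ ℚP.<? w x))) ⟩
  sumℚ (λ x → ℕ→ℚ (𝟙 (0ℚ ℚP.<? w x))) ℚ.* u
    ≡⟨ ℚP.*-comm _ u ⟩
  u ℚ.* sumℚ (λ x → ℕ→ℚ (𝟙 (0ℚ ℚP.<? w x)))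
    ≡⟨ *-distribˡ-sumℚ u (λ x → ℕ→ℚ (𝟙 (0ℚ ℚP.<? w x))) ⟩
  sumℚ (λ x → u ℚ.* ℕ→ℚ (𝟙 (0ℚ ℚP.<? w x)))
    ≤⟨ sumℚ-mono termwise ⟩
  sumℚ w ∎
  where
  open ℚP.≤-Reasoning
  termwise : ∀ x → u ℚ.* ℕ→ℚ (𝟙 (0ℚ ℚP.<? w x)) ℚ.≤ w x
  termwise x = by-cases (0ℚ ℚP.<? w x)
    where
    by-cases : (wx>0? : Dec (0ℚ ℚ.< w x)) → u ℚ.* ℕ→ℚ (𝟙 wx>0?) ℚ.≤ w x
    by-cases (yes wx>0) = subst (ℚ._≤ w x) (sym (ℚP.*-identityʳ u)) (w>0⇒≥u x wx>0)
    by-cases (no  _)    = subst (ℚ._≤ w x) (sym (ℚP.*-zeroʳ u)) (w≥0 x)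

sum≡1⇒positive : ∀ {n} (w : Fin n → ℚ) → sumℚ w ≡ 1ℚ → ∃ λ i → 0ℚ ℚ.< w i
sum≡1⇒positive w Σw≡1 with FP.any? (λ i → 0ℚ ℚP.<? w i)
... | yes ∃w>0 = ∃w>0
... | no  ∄w>0 = ⊥-elim (ℚP.<-irrefl refl (ℚP.<-≤-trans (ℚP.positive⁻¹ 1ℚ)
                   (subst (ℚ._≤ 0ℚ) Σw≡1 (sumℚ-nonPos (λ i → ℚP.≮⇒≥ (λ wi>0 → ∄w>0 (i , wi>0)))))))

doublyStochastic⇒granular : ∀ {r} .{{_ : NonZero r}} {n} {M : Matrix n} →
                            DoublyStochastic M → MultiplesOf1/ r M → Granular r M
doublyStochastic⇒granular {r} {n} {M} (M≥0 , rows , cols) multiple = record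
  { nonNeg         = M≥0
  ; row-support    = λ x → sum≡1⇒positive (M x) (rows x)
  ; positive⇒≥1/r  = ≥1/r
  ; column-support = λ i → ℕ→ℚ-cancel-≤ (ℚP.*-cancelʳ-≤-pos ((ℤ.+ 1) / r) {{ℚ.positive (1/r-pos r)}}
      (ℚP.≤-trans (count-positive*lower≤sum (λ x → M x i) (λ x → M≥0 x i) (λ x → ≥1/r x i))
                  (ℚP.≤-reflexive (trans (cols i) (sym (r*1/r≡1 r))))))
  }
  where
  ≥1/r : ∀ x i → 0ℚ ℚ.< M x i → (ℤ.+ 1) / r ℚ.≤ M x i
  ≥1/r x i Mxi>0 with multiple x i
  ... | k , Mxi≡k/r rewrite Mxi≡k/r = positive-multiple⇒≥1/r r k Mxi>0

1/r≤1 : ∀ r .{{_ : NonZero r}} → (ℤ.+ 1) / r ℚ.≤ 1ℚ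
1/r≤1 r = subst₂ ℚ._≤_ (ℚP.*-identityˡ ((ℤ.+ 1) / r)) (r*1/r≡1 r)
  (ℚP.*-monoʳ-≤-nonNeg ((ℤ.+ 1) / r) {{ℚ.nonNegative (ℚP.<⇒≤ (1/r-pos r))}} (ℕ→ℚ-mono-≤ (ℕ.>-nonZero⁻¹ r)))

permMat-entry : ∀ {n} (π : Permutation′ n) x i →
                (π ⟨$⟩ʳ x ≡ i × permMat π x i ≡ 1ℚ) ⊎ (π ⟨$⟩ʳ x ≢ i × permMat π x i ≡ 0ℚ)
permMat-entry π x i with π ⟨$⟩ʳ x F.≟ i
... | yes πx≡i = inj₁ (πx≡i , refl)
... | no  πx≢i = inj₂ (πx≢i , refl)

permMat-at-position : ∀ {n} (π : Permutation′ n) x → permMat π x (π ⟨$⟩ʳ x) ≡ 1ℚ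
permMat-at-position π x rewrite dec-true (π ⟨$⟩ʳ x F.≟ π ⟨$⟩ʳ x) refl = refl

permMat-positive : ∀ {n} (π : Permutation′ n) {x i} → 0ℚ ℚ.< permMat π x i → π ⟨$⟩ʳ x ≡ i
permMat-positive π {x} {i} entry>0 with permMat-entry π x i
... | inj₁ (πx≡i , _)  = πx≡i
... | inj₂ (_ , entry≡0) = ⊥-elim (ℚP.<-irrefl refl (subst (0ℚ ℚ.<_) entry≡0 entry>0))

permMat-granular : ∀ {r} .{{_ : NonZero r}} {n} (π : Permutation′ n) → Granular r (permMat π)
permMat-granular {r} {n} π = record
  { nonNeg         = nonNeg
  ; row-support    = λ x → π ⟨$⟩ʳ x , subst (0ℚ ℚ.<_) (sym (permMat-at-position π x)) (ℚP.positive⁻¹ 1ℚ)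
  ; positive⇒≥1/r  = λ x i entry>0 → ≥1/r x i (permMat-positive π entry>0)
  ; column-support = λ i → begin
      sumℕ (λ x → 𝟙 (0ℚ ℚP.<? permMat π x i))
        ≤⟨ sumℕ-mono (λ x → 𝟙-mono (in-column i) (0ℚ ℚP.<? permMat π x i) (x F.≟ π ⟨$⟩ˡ i)) ⟩
      sumℕ (λ x → 𝟙 (x F.≟ π ⟨$⟩ˡ i))
        ≡⟨ sumℕ-δ (π ⟨$⟩ˡ i) (λ _ → 1) ⟩
      1
        ≤⟨ ℕ.>-nonZero⁻¹ r ⟩
      r ∎
  }
  where
  open NP.≤-Reasoning
  nonNeg : ∀ x i → 0ℚ ℚ.≤ permMat π x i
  nonNeg x i with permMat-entry π x i
  ... | inj₁ (_ , entry≡1) = subst (0ℚ ℚ.≤_) (sym entry≡1) (ℚP.<⇒≤ (ℚP.positive⁻¹ 1ℚ))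
  ... | inj₂ (_ , entry≡0) = subst (0ℚ ℚ.≤_) (sym entry≡0) ℚP.≤-refl
  ≥1/r : ∀ x i → π ⟨$⟩ʳ x ≡ i → (ℤ.+ 1) / r ℚ.≤ permMat π x i
  ≥1/r x i πx≡i with permMat-entry π x i
  ... | inj₁ (_ , entry≡1) = subst ((ℤ.+ 1) / r ℚ.≤_) (sym entry≡1) (1/r≤1 r)
  ... | inj₂ (πx≢i , _)    = ⊥-elim (πx≢i πx≡i)
  in-column : ∀ i {x} → 0ℚ ℚ.< permMat π x i → x ≡ π ⟨$⟩ˡ i
  in-column i {x} entry>0 = trans (sym (inverseˡ π)) (cong (π ⟨$⟩ˡ_) (permMat-positive π entry>0))

Granular-resp : ∀ {r} .{{_ : NonZero r}} {n} {M N : Matrix n} →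
                (∀ x i → M x i ≡ N x i) → Granular r M → Granular r N
Granular-resp {r} M≗N gran = record
  { nonNeg         = λ x i → subst (0ℚ ℚ.≤_) (M≗N x i) (nonNeg x i)
  ; row-support    = λ x → proj₁ (row-support x) , subst (0ℚ ℚ.<_) (M≗N x _) (proj₂ (row-support x))
  ; positive⇒≥1/r  = λ x i Nxi>0 →
      subst ((ℤ.+ 1) / r ℚ.≤_) (M≗N x i) (positive⇒≥1/r x i (subst (0ℚ ℚ.<_) (sym (M≗N x i)) Nxi>0))
  ; column-support = λ i → subst (_≤ r) (sumℕ-cong (λ x → cong (λ q → 𝟙 (0ℚ ℚP.<? q)) (M≗N x i))) (column-support i)
  }
  where open Granular gran

leftmost-permMat : ∀ {n} (π : Permutation′ n) x {w : Fin n → ℚ} → (∀ i → w i ≡ permMat π x i) → leftmost w ≡ pos π x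
leftmost-permMat π x {w} w≗row with leftmost-attained w {π ⟨$⟩ʳ x}
  (subst (0ℚ ℚ.<_) (sym (trans (w≗row (π ⟨$⟩ʳ x)) (permMat-at-position π x))) (ℚP.positive⁻¹ 1ℚ))
... | k , k≡ , wk>0 = trans (sym k≡) (cong toℕ (sym (permMat-positive π (subst (0ℚ ℚ.<_) (w≗row k) wk>0))))

-- Transport cost of moving leftmost supports

leftmostShift : ∀ {n} → Matrix n → Matrix n → ℕ
leftmostShift A B = sumℕ (λ x → ℕ.∣ leftmost (A x) - leftmost (B x) ∣)

transport-lower-bound : ∀ {n} (w : Fin n → ℚ) {c d} → c ≤ d → (∀ k → 0ℚ ℚ.≤ w k) →
                        (∀ k → toℕ k < d → w k ℚ.≤ 0ℚ) →
                        ℕ→ℚ (d ∸ c) ℚ.* sumℚ w ℚ.≤ sumℚ (λ k → ℕ→ℚ ℕ.∣ c - toℕ k ∣ ℚ.* w k)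
transport-lower-bound w {c} {d} c≤d w≥0 w<d≤0 =
  subst (ℚ._≤ _) (sym (*-distribˡ-sumℚ (ℕ→ℚ (d ∸ c)) w)) (sumℚ-mono termwise)
  where
  termwise : ∀ k → ℕ→ℚ (d ∸ c) ℚ.* w k ℚ.≤ ℕ→ℚ ℕ.∣ c - toℕ k ∣ ℚ.* w k
  termwise k with toℕ k ℕ.<? d
  ... | yes k<d rewrite ℚP.≤-antisym (w<d≤0 k k<d) (w≥0 k)
                      | ℚP.*-zeroʳ (ℕ→ℚ (d ∸ c)) | ℚP.*-zeroʳ (ℕ→ℚ ℕ.∣ c - toℕ k ∣) = ℚP.≤-refl
  ... | no  k≮d = ℚP.*-monoʳ-≤-nonNeg (w k) {{ℚ.nonNegative (w≥0 k)}} (ℕ→ℚ-mono-≤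
        (subst (d ∸ c ≤_) (sym (NP.m≤n⇒∣m-n∣≡n∸m (NP.≤-trans c≤d (NP.≮⇒≥ k≮d))))
               (NP.∸-monoˡ-≤ c (NP.≮⇒≥ k≮d))))

module _ {r} .{{_ : NonZero r}} {n} {A B : Matrix n} (A-gran : Granular r A) (B-gran : Granular r B)
         {F : Flow n} (flow : IsFlow A B F) where

  private
    u : ℚ
    u = (ℤ.+ 1) / r
    F≥0 : ∀ x i j → 0ℚ ℚ.≤ F x i j
    F≥0 = proj₁ flow
    F-into : ∀ x j → sumℚ (λ i → F x i j) ≡ B x j
    F-into = proj₁ (proj₂ flow)
    F-out : ∀ x i → sumℚ (λ j → F x i j) ≡ A x i
    F-out = proj₂ (proj₂ flow)
    module A = Granular-leftmost A-gran
    module B = Granular-leftmost B-gran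

    cost : Fin n → Fin n → Fin n → ℚ
    cost x i j = ℕ→ℚ ℕ.∣ toℕ i - toℕ j ∣ ℚ.* F x i j

    cost≥0 : ∀ x i j → 0ℚ ℚ.≤ cost x i j
    cost≥0 x i j = ℚP.nonNegative⁻¹ _ {{ℚP.nonNeg*nonNeg⇒nonNeg (ℕ→ℚ ℕ.∣ toℕ i - toℕ j ∣)
      {{ℚ.nonNegative (ℕ→ℚ-nonNeg ℕ.∣ toℕ i - toℕ j ∣)}} (F x i j) {{ℚ.nonNegative (F≥0 x i j)}}}}

    rowCost : Fin n → ℚ
    rowCost x = sumℚ λ i → sumℚ λ j → cost x i j

    displaced-mass : (w : Fin n → ℚ) {c d : ℕ} → c ≤ d → (∀ k → 0ℚ ℚ.≤ w k) →
                     (∀ k → toℕ k < d → w k ℚ.≤ 0ℚ) → u ℚ.≤ sumℚ w →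
                     ℕ→ℚ (d ∸ c) ℚ.* u ℚ.≤ sumℚ (λ k → ℕ→ℚ ℕ.∣ c - toℕ k ∣ ℚ.* w k)
    displaced-mass w {c} {d} c≤d w≥0 w<d≤0 u≤Σw = ℚP.≤-trans
      (ℚP.*-monoˡ-≤-nonNeg (ℕ→ℚ (d ∸ c)) {{ℚ.nonNegative (ℕ→ℚ-nonNeg (d ∸ c))}} u≤Σw)
      (transport-lower-bound w c≤d w≥0 w<d≤0)

    -- The mass ≥ 1/r at the leftmost support of one row must reach the other row's support.
    row-displacement : ∀ x → ℕ→ℚ ℕ.∣ leftmost (A x) - leftmost (B x) ∣ ℚ.* u ℚ.≤ rowCost x
    row-displacement x with leftmost (A x) ℕ.≤? leftmost (B x) | A.leftmost-column x | B.leftmost-column x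
    ... | yes a≤b | k , k≡a , u≤Axk | _ = begin
      ℕ→ℚ ℕ.∣ a - b ∣ ℚ.* u
        ≡⟨ cong (λ m → ℕ→ℚ m ℚ.* u) (NP.m≤n⇒∣m-n∣≡n∸m a≤b) ⟩
      ℕ→ℚ (b ∸ a) ℚ.* u
        ≤⟨ displaced-mass (F x k) a≤b (F≥0 x k)
             (λ j j<b → ℚP.≤-trans (subst (F x k j ℚ.≤_) (F-into x j) (term≤sumℚ (λ i → F≥0 x i j) k))
                                   (B.before-leftmost x j j<b))
             (subst (u ℚ.≤_) (sym (F-out x k)) u≤Axk) ⟩
      sumℚ (λ j → ℕ→ℚ ℕ.∣ a - toℕ j ∣ ℚ.* F x k j)
        ≡⟨ sumℚ-cong (λ j → cong (λ m → ℕ→ℚ ℕ.∣ m - toℕ j ∣ ℚ.* F x k j) (sym k≡a)) ⟩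
      sumℚ (λ j → cost x k j)
        ≤⟨ term≤sumℚ (λ i → sumℚ-nonNeg (cost≥0 x i)) k ⟩
      rowCost x ∎
      where
      open ℚP.≤-Reasoning
      a b : ℕ
      a = leftmost (A x)
      b = leftmost (B x)
    ... | no a≰b | _ | k , k≡b , u≤Bxk = begin
      ℕ→ℚ ℕ.∣ a - b ∣ ℚ.* u
        ≡⟨ cong (λ m → ℕ→ℚ m ℚ.* u) (NP.m≤n⇒∣n-m∣≡n∸m b≤a) ⟩
      ℕ→ℚ (a ∸ b) ℚ.* u
        ≤⟨ displaced-mass (λ i → F x i k) b≤a (λ i → F≥0 x i k)
             (λ i i<a → ℚP.≤-trans (subst (F x i k ℚ.≤_) (F-out x i) (term≤sumℚ (F≥0 x i) k))
                                   (A.before-leftmost x i i<a))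
             (subst (u ℚ.≤_) (sym (F-into x k)) u≤Bxk) ⟩
      sumℚ (λ i → ℕ→ℚ ℕ.∣ b - toℕ i ∣ ℚ.* F x i k)
        ≡⟨ sumℚ-cong (λ i → cong (λ m → ℕ→ℚ m ℚ.* F x i k)
                                 (trans (cong (λ m → ℕ.∣ m - toℕ i ∣) (sym k≡b)) (NP.∣-∣-comm (toℕ k) (toℕ i)))) ⟩
      sumℚ (λ i → cost x i k)
        ≤⟨ sumℚ-mono (λ i → term≤sumℚ (cost≥0 x i) k) ⟩
      rowCost x ∎
      where
      open ℚP.≤-Reasoning
      a b : ℕ
      a = leftmost (A x)
      b = leftmost (B x)
      b≤a : b ≤ a
      b≤a = NP.<⇒≤ (NP.≰⇒> a≰b)

  leftmostShift≤cost : ℕ→ℚ (leftmostShift A B) ℚ.≤ ℕ→ℚ r ℚ.* flowCost F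
  leftmostShift≤cost = begin
    ℕ→ℚ D                      ≡⟨ ℚP.*-identityˡ (ℕ→ℚ D) ⟨
    1ℚ ℚ.* ℕ→ℚ D               ≡⟨ cong (ℚ._* ℕ→ℚ D) (r*1/r≡1 r) ⟨
    (ℕ→ℚ r ℚ.* u) ℚ.* ℕ→ℚ D    ≡⟨ ℚP.*-assoc (ℕ→ℚ r) u (ℕ→ℚ D) ⟩
    ℕ→ℚ r ℚ.* (u ℚ.* ℕ→ℚ D)    ≤⟨ ℚP.*-monoˡ-≤-nonNeg (ℕ→ℚ r) {{ℚ.nonNegative (ℕ→ℚ-nonNeg r)}} displacement≤cost ⟩
    ℕ→ℚ r ℚ.* flowCost F       ∎
    where
    open ℚP.≤-Reasoning
    D : ℕ
    D = leftmostShift A B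
    displacement≤cost : u ℚ.* ℕ→ℚ D ℚ.≤ flowCost F
    displacement≤cost = begin
      u ℚ.* ℕ→ℚ D
        ≡⟨ cong (u ℚ.*_) (ℕ→ℚ-sumℕ (λ x → ℕ.∣ leftmost (A x) - leftmost (B x) ∣)) ⟩
      u ℚ.* sumℚ (λ x → ℕ→ℚ ℕ.∣ leftmost (A x) - leftmost (B x) ∣)
        ≡⟨ *-distribˡ-sumℚ u (λ x → ℕ→ℚ ℕ.∣ leftmost (A x) - leftmost (B x) ∣) ⟩
      sumℚ (λ x → u ℚ.* ℕ→ℚ ℕ.∣ leftmost (A x) - leftmost (B x) ∣)
        ≤⟨ sumℚ-mono (λ x → subst (ℚ._≤ rowCost x) (ℚP.*-comm _ u) (row-displacement x)) ⟩
      flowCost F ∎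

sumRoundsℚ-mono : ∀ T {f g : ℕ → ℚ} → (∀ t → Round T t → f t ℚ.≤ g t) → sumRoundsℚ T f ℚ.≤ sumRoundsℚ T g
sumRoundsℚ-mono zero    f≤g = ℚP.≤-refl
sumRoundsℚ-mono (suc T) f≤g = ℚP.+-mono-≤ (sumRoundsℚ-mono T (λ t (1≤t , t≤T) → f≤g t (1≤t , NP.m≤n⇒m≤1+n t≤T)))
                                          (f≤g (suc T) (s≤s z≤n , NP.≤-refl))

sumRoundsℕ-affine : ∀ T c d (f : ℕ → ℕ) → sumRoundsℕ T (λ t → c * f t + d) ≡ c * sumRoundsℕ T f + d * T
sumRoundsℕ-affine zero    c d f = sym (cong₂ _+_ (NP.*-zeroʳ c) (NP.*-zeroʳ d))
sumRoundsℕ-affine (suc T) c d f = begin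
  sumRoundsℕ T (λ t → c * f t + d) + (c * f (suc T) + d)
    ≡⟨ cong (_+ (c * f (suc T) + d)) (sumRoundsℕ-affine T c d f) ⟩
  (c * sumRoundsℕ T f + d * T) + (c * f (suc T) + d)
    ≡⟨ regroup c d (sumRoundsℕ T f) (f (suc T)) T ⟩
  c * (sumRoundsℕ T f + f (suc T)) + d * suc T ∎
  where
  open ≡-Reasoning
  regroup : ∀ c d s x T → (c * s + d * T) + (c * x + d) ≡ c * (s + x) + d * suc T
  regroup = solve-∀

ℕ→ℚ-sumRounds : ∀ T (f : ℕ → ℕ) → ℕ→ℚ (sumRoundsℕ T f) ≡ sumRoundsℚ T (λ t → ℕ→ℚ (f t))
ℕ→ℚ-sumRounds zero    f = refl
ℕ→ℚ-sumRounds (suc T) f = trans (ℕ→ℚ-homo-+ (sumRoundsℕ T f) (f (suc T)))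
                                (cong (ℚ._+ ℕ→ℚ (f (suc T))) (ℕ→ℚ-sumRounds T f))

*-distribˡ-sumRoundsℚ : ∀ T c (f : ℕ → ℚ) → c ℚ.* sumRoundsℚ T f ≡ sumRoundsℚ T (λ t → c ℚ.* f t)
*-distribˡ-sumRoundsℚ zero    c f = ℚP.*-zeroʳ c
*-distribˡ-sumRoundsℚ (suc T) c f = trans (ℚP.*-distribˡ-+ c (sumRoundsℚ T f) (f (suc T)))
                                          (cong (ℚ._+ c ℚ.* f (suc T)) (*-distribˡ-sumRoundsℚ T c f))

telescope : ∀ T (a c Φ : ℕ → ℕ) → (∀ t → Round T t → a t + Φ t ≤ Φ (ℕ.pred t) + c t) →
            sumRoundsℕ T a + Φ T ≤ Φ 0 + sumRoundsℕ T c
telescope zero    a c Φ step = NP.≤-reflexive (NP.+-comm 0 (Φ 0))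
telescope (suc T) a c Φ step = begin
  (sumRoundsℕ T a + a (suc T)) + Φ (suc T) ≡⟨ NP.+-assoc (sumRoundsℕ T a) (a (suc T)) (Φ (suc T)) ⟩
  sumRoundsℕ T a + (a (suc T) + Φ (suc T)) ≤⟨ NP.+-monoʳ-≤ (sumRoundsℕ T a) (step (suc T) (s≤s z≤n , NP.≤-refl)) ⟩
  sumRoundsℕ T a + (Φ T + c (suc T))       ≡⟨ NP.+-assoc (sumRoundsℕ T a) (Φ T) (c (suc T)) ⟨
  (sumRoundsℕ T a + Φ T) + c (suc T)       ≤⟨ NP.+-monoˡ-≤ (c (suc T)) (telescope T a c Φ
                                                 (λ t (1≤t , t≤T) → step t (1≤t , NP.m≤n⇒m≤1+n t≤T))) ⟩
  (Φ 0 + sumRoundsℕ T c) + c (suc T)       ≡⟨ NP.+-assoc (Φ 0) (sumRoundsℕ T c) (c (suc T)) ⟩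
  Φ 0 + (sumRoundsℕ T c + c (suc T))       ∎
  where open NP.≤-Reasoning

leftmost-zero : ∀ {n} (w : Fin (suc n) → ℚ) → 0ℚ ℚ.< w zero → leftmost w ≡ 0
leftmost-zero w w₀>0 with 0ℚ ℚP.<? w zero
... | yes _    = refl
... | no  w₀≯0 = ⊥-elim (w₀≯0 w₀>0)

round-bound : ∀ {r} .{{_ : NonZero r}} {n} {π σ : Permutation′ n} {e} {A B : Matrix n} →
              MoveToFront π e σ → Granular r A → Granular r B → leftmost (B e) ≡ 0 →
              dKT σ π + inversions σ (λ x → leftmost (B x))
              ≤ inversions π (λ x → leftmost (A x)) + (r * leftmostShift B A + r)
round-bound {r} {π = π} {σ} {e} {A} {B} mtf A-gran B-gran Be≡0 = begin
  dKT σ π + inversions σ fB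
    ≤⟨ MoveToFront-properties.dKT+inversions-moveToFront {π = π} {σ} {e} mtf fB Be≡0 ⟩
  inversions π fB + sumℕ (λ x → 𝟙 (fB x ℕ.≟ 0))
    ≤⟨ NP.+-mono-≤ (inversions-change π {fA} {fB} A.leftmost-fibres B.leftmost-fibres) (B.leftmost-fibres 0) ⟩
  (inversions π fA + r * leftmostShift B A) + r
    ≡⟨ NP.+-assoc (inversions π fA) (r * leftmostShift B A) r ⟩
  inversions π fA + (r * leftmostShift B A + r) ∎
  where
  open NP.≤-Reasoning
  module A = Granular-leftmost A-gran
  module B = Granular-leftmost B-gran
  fA fB : Fin _ → ℕ
  fA x = leftmost (A x)
  fB x = leftmost (B x)

module MoveToFront-along {r} .{{_ : NonZero r}} {m T : ℕ}
  (π : ℕ → Permutation′ (suc m)) (e : ℕ → Fin (suc m)) (Â : ℕ → Matrix (suc m))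
  (moves : ∀ t → Round T t → MoveToFront (π (ℕ.pred t)) (e t) (π t))
  (granular : ∀ t → t ≤ T → Granular r (Â t))
  (moved-supported : ∀ t → Round T t → 0ℚ ℚ.< Â t (e t) zero)
  (initial : ∀ x → leftmost (Â 0 x) ≡ pos (π 0) x) where

  potential : ℕ → ℕ
  potential t = inversions (π t) (λ x → leftmost (Â t x))

  shift : ℕ → ℕ
  shift t = leftmostShift (Â t) (Â (ℕ.pred t))

  step : ∀ t → Round T t → dKT (π t) (π (ℕ.pred t)) + potential t ≤ potential (ℕ.pred t) + (r * shift t + r)
  step zero    (() , _)
  step (suc t) round@(_ , 1+t≤T) = round-bound {π = π t} {π (suc t)} {e (suc t)} {Â t} {Â (suc t)} (moves (suc t) round)
    (granular t (NP.≤-trans (NP.n≤1+n t) 1+t≤T)) (granular (suc t) 1+t≤T)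
    (leftmost-zero (Â (suc t) (e (suc t))) (moved-supported (suc t) round))

  dKT-total≤ : sumRoundsℕ T (λ t → dKT (π t) (π (ℕ.pred t))) ≤ r * sumRoundsℕ T shift + r * T
  dKT-total≤ = begin
    sumRoundsℕ T (λ t → dKT (π t) (π (ℕ.pred t)))
      ≤⟨ NP.m≤m+n _ (potential T) ⟩
    sumRoundsℕ T (λ t → dKT (π t) (π (ℕ.pred t))) + potential T
      ≤⟨ telescope T (λ t → dKT (π t) (π (ℕ.pred t))) (λ t → r * shift t + r) potential step ⟩
    potential 0 + sumRoundsℕ T (λ t → r * shift t + r)
      ≡⟨ cong₂ _+_ (inversions-self (π 0) initial) (sumRoundsℕ-affine T r r shift) ⟩
    r * sumRoundsℕ T shift + r * T ∎
    where open NP.≤-Reasoning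

shift-total≤ : ∀ {r} .{{_ : NonZero r}} {n} T (Â : ℕ → Matrix n) (v̂ : ℕ → ℚ) →
               (∀ t → t ≤ T → Granular r (Â t)) → DFRValues T Â v̂ →
               ℕ→ℚ (sumRoundsℕ T (λ t → leftmostShift (Â t) (Â (ℕ.pred t)))) ℚ.≤ ℕ→ℚ r ℚ.* sumRoundsℚ T v̂
shift-total≤ {r} T Â v̂ granular dfr = begin
  ℕ→ℚ (sumRoundsℕ T shift)               ≡⟨ ℕ→ℚ-sumRounds T shift ⟩
  sumRoundsℚ T (λ t → ℕ→ℚ (shift t))     ≤⟨ sumRoundsℚ-mono T per-round ⟩
  sumRoundsℚ T (λ t → ℕ→ℚ r ℚ.* v̂ t)     ≡⟨ *-distribˡ-sumRoundsℚ T (ℕ→ℚ r) v̂ ⟨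
  ℕ→ℚ r ℚ.* sumRoundsℚ T v̂               ∎
  where
  open ℚP.≤-Reasoning
  shift : ℕ → ℕ
  shift t = leftmostShift (Â t) (Â (ℕ.pred t))
  per-round : ∀ t → Round T t → ℕ→ℚ (shift t) ℚ.≤ ℕ→ℚ r ℚ.* v̂ t
  per-round zero    (() , _)
  per-round (suc t) round@(_ , 1+t≤T) with dfr (suc t) round
  ... | (F , flow , cost≡v) , _ = subst (λ v → ℕ→ℚ (shift (suc t)) ℚ.≤ ℕ→ℚ r ℚ.* v) cost≡v
        (leftmostShift≤cost (granular (suc t) 1+t≤T) (granular t (NP.≤-trans (NP.n≤1+n t) 1+t≤T)) flow)

rS+rT≤2r²V+rT : ∀ r .{{_ : NonZero r}} S T V → ℕ→ℚ S ℚ.≤ ℕ→ℚ r ℚ.* V →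
                ℕ→ℚ (r * S + r * T) ℚ.≤ ℕ→ℚ (2 * r * r) ℚ.* V ℚ.+ ℕ→ℚ (r * T)
rS+rT≤2r²V+rT r S T V S≤rV = begin
  ℕ→ℚ (r * S + r * T)
    ≡⟨ trans (ℕ→ℚ-homo-+ (r * S) (r * T)) (cong (ℚ._+ ℕ→ℚ (r * T)) (ℕ→ℚ-homo-* r S)) ⟩
  ℕ→ℚ r ℚ.* ℕ→ℚ S ℚ.+ ℕ→ℚ (r * T)
    ≤⟨ ℚP.+-monoˡ-≤ (ℕ→ℚ (r * T)) (ℚP.*-monoˡ-≤-nonNeg (ℕ→ℚ r) {{r≥0}} S≤rV) ⟩
  ℕ→ℚ r ℚ.* (ℕ→ℚ r ℚ.* V) ℚ.+ ℕ→ℚ (r * T)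
    ≡⟨ cong (ℚ._+ ℕ→ℚ (r * T)) (trans (sym (ℚP.*-assoc (ℕ→ℚ r) (ℕ→ℚ r) V)) (cong (ℚ._* V) (sym (ℕ→ℚ-homo-* r r)))) ⟩
  ℕ→ℚ (r * r) ℚ.* V ℚ.+ ℕ→ℚ (r * T)
    ≤⟨ ℚP.+-monoˡ-≤ (ℕ→ℚ (r * T)) (ℚP.*-monoʳ-≤-nonNeg V {{ℚ.nonNegative V≥0}}
                                      (ℕ→ℚ-mono-≤ (NP.*-monoˡ-≤ r (NP.m≤n*m r 2)))) ⟩
  ℕ→ℚ (2 * r * r) ℚ.* V ℚ.+ ℕ→ℚ (r * T) ∎
  where
  open ℚP.≤-Reasoning
  r≥0 : ℚ.NonNegative (ℕ→ℚ r)
  r≥0 = ℚ.nonNegative (ℕ→ℚ-nonNeg r)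
  V≥0 : 0ℚ ℚ.≤ V
  V≥0 = ℚP.*-cancelˡ-≤-pos (ℕ→ℚ r) {{ℚP.normalize-pos r 1}}
          (subst (ℚ._≤ ℕ→ℚ r ℚ.* V) (sym (ℚP.*-zeroʳ (ℕ→ℚ r))) (ℚP.≤-trans (ℕ→ℚ-nonNeg S) S≤rV))

open import Data.Integer using (+_)
import Data.Nat

lemma20 : (r : ℕ) → .{{_ : NonZero r}} → (m T : ℕ)
    → (R : ℕ → Subset (suc m)) → (π0 : Permutation′ (suc m))
    → (∀ t → Round T t → ∣ R t ∣ ≤ r)
    → (A : ℕ → Matrix (suc m)) → OptimalMTF T R π0 A
    → (π : ℕ → Permutation′ (suc m)) → (e : ℕ → Fin (suc m))
    → GreedyRounding r T R π0 A π e
    → (Â : ℕ → Matrix (suc m))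
    → (∀ x i → Â 0 x i ≡ permMat π0 x i)
    → (∀ t → Round T t → DoublyStochastic (Â t))
    → (∀ t → Round T t → MultiplesOf1/ r (Â t))
    → (∀ t → Round T t → (+ 1) / r ℚ.≤ Â t (e t) zero)
    → (v̂ : ℕ → ℚ) → DFRValues T Â v̂
    → ℕ→ℚ (sumRoundsℕ T (λ t → dKT (π t) (π (Data.Nat.pred t))))
        ℚ.≤ ℕ→ℚ (2 * r * r) ℚ.* sumRoundsℚ T v̂ ℚ.+ ℕ→ℚ (r * T)
lemma20 r m T R π0 _ A _ π e (π-starts-at-π0 , greedy) Â Â0≗π0 doublyStochastic multiples moved≥1/r v̂ dfr =
  ℚP.≤-trans (ℕ→ℚ-mono-≤ dKT-total≤)
    (rS+rT≤2r²V+rT r (sumRoundsℕ T shift) T (sumRoundsℚ T v̂) (shift-total≤ T Â v̂ granular dfr))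
  where
  granular : ∀ t → t ≤ T → Granular r (Â t)
  granular zero    _     = Granular-resp (λ x i → sym (Â0≗π0 x i)) (permMat-granular π0)
  granular (suc t) 1+t≤T = doublyStochastic⇒granular (doublyStochastic (suc t) (s≤s z≤n , 1+t≤T))
                                                     (multiples (suc t) (s≤s z≤n , 1+t≤T))
  open MoveToFront-along π e Â (λ t round → proj₂ (proj₂ (greedy t round))) granular
    (λ t round → ℚP.<-≤-trans (1/r-pos r) (moved≥1/r t round))
    (λ x → trans (leftmost-permMat π0 x (Â0≗π0 x)) (cong toℕ (sym (π-starts-at-π0 x))))
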